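{- For every positive integer $n$, the union over all $i\in\mathbb{N}=\{1,2,3,\ldots\}$ of the sets of terms of the left diagonals $L_{2^n i-2^{n-1}}$ of the Calkin–Wilf tree equals $(n-1,n]\cap\mathbb{Q}^{+}$.
   Context: The Calkin–Wilf tree is the rooted infinite binary tree whose vertices are labeled by fractions: the root is $\frac{1}{1}$, and a vertex labeled $\frac{a}{b}$ has left child $\frac{a}{a+b}$ and right child $\frac{a+b}{b}$. The root is at level $1$; level $k$ has $2^{k-1}$ vertices, ordered from left to right so that the children of the $i$-th vertex of level $k$ are the $(2i-1)$-th (left child) and $(2i)$-th (right child) vertices of level $k+1$. For $m\ge1$, let $k_m$ be the least $k\ge1$ with $2^{k-1}\ge m$. The $m$-th left diagonal $L_m$ is the sequence whose $j$-th term ($j\ge1$) is the $m$-th vertex (counted from the left) of level $k_m+j-1$. $\mathbb{Q}^+$ denotes the set of positive rationals. -}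

module Defs where

open import Data.Nat using (ℕ; zero; suc; _+_; _*_; _∸_; _^_; _/_; _%_)
open import Data.Nat.Logarithm using (⌈log₂_⌉)
open import Data.Product using (_×_; _,_)
open import Data.Integer using (+_)
open import Data.Rational using (ℚ) renaming (_/_ to _÷_)

-- A Calkin–Wilf label a/b is stored as a pair (a , b') with b = suc b'
-- (so the denominator is positive by construction).
Frac : Set
Frac = ℕ × ℕ

-- left child a/(a+b) and right child (a+b)/b
leftChild : Frac → Frac
leftChild (a , b') = a , (a + b')        -- denominator a + suc b' = suc (a + b')

rightChild : Frac → Frac
rightChild (a , b') = (a + suc b') , b'

-- vertex d p : the (p+1)-th vertex (from the left) of level d+1, for p < 2^d.
-- The (i)-th vertex of level k has children the (2i-1)-th and (2i)-th of
-- level k+1; in 0-based indices, vertex p of level d+2 is the left child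
-- (p even) or right child (p odd) of vertex p/2 of level d+1.
vertex : ℕ → ℕ → Frac
vertex zero    p = 1 , 0
vertex (suc d) p with p % 2
... | zero  = leftChild  (vertex d (p / 2))
... | suc _ = rightChild (vertex d (p / 2))

toℚ : Frac → ℚ
toℚ (a , b') = (+ a) ÷ suc b'

-- k_m - 1 = least d with 2^d ≥ m, i.e. ⌈log₂ m⌉
-- The j-th term (j ≥ 1) of the m-th left diagonal L_m (m ≥ 1):
-- the m-th vertex of level k_m + j - 1.
diagTerm : ℕ → ℕ → ℚ
diagTerm m j = toℚ (vertex (⌈log₂ m ⌉ + (j ∸ 1)) (m ∸ 1))

-- Let n = k + 1 and m = 2ⁿ·i − 2ⁿ⁻¹ with i = i' + 1.  In binary, the 0-based
-- position m − 1 of L_m in its level is the position 2·i' followed by k ones.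
-- Reading positions as paths from the root (bit 0 = left, bit 1 = right), every
-- term of L_m is therefore R^k(v), where R is the right-child map
-- R(a/b) = (a+b)/b = a/b + 1 and v is a vertex at an even position: either the
-- root 1/1 or a left child a/(a+b).  Such v are exactly the fractions in (0,1],
-- so the terms of L_m lie in (k, k+1] = (n−1, n].
-- Conversely, a reduced q ∈ (k, k+1] is R^k(x/y) with x/y ∈ (0,1] reduced; since
-- the Calkin–Wilf tree contains every reduced fraction (the subtractive
-- Euclidean algorithm walks back to the root), x/y sits at some even position
-- 2·p of some level d, and then q is a term of the diagonal with i = p + 1.
module Submission where

open import Defs

module Tree where

  open import Data.Nat
  open import Data.Nat.Properties
  open import Data.Nat.DivMod using (m*n%n≡0; m*n/n≡m; [m+kn]%n≡m%n; +-distrib-/-∣ʳ)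
  open import Data.Nat.Divisibility using (_∣_; divides; ∣-refl; ∣-trans; ∣m∣n⇒∣m+n)
  open import Data.Nat.Coprimality using (Coprime) renaming (sym to coprime-sym)
  open import Data.Product
  open import Data.Sum using (inj₁; inj₂)
  open import Relation.Binary.PropositionalEquality
  open ≡-Reasoning

  vertex-left : ∀ d p → vertex (suc d) (p * 2) ≡ leftChild (vertex d p)
  vertex-left d p with (p * 2) % 2 | m*n%n≡0 p 2
  ... | .0 | refl = cong (λ r → leftChild (vertex d r)) (m*n/n≡m p 2)

  vertex-right : ∀ d p → vertex (suc d) (1 + p * 2) ≡ rightChild (vertex d p)
  vertex-right d p with (1 + p * 2) % 2 | [m+kn]%n≡m%n 1 p 2
  ... | .1 | refl = cong (λ r → rightChild (vertex d r)) half
    where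
      half : (1 + p * 2) / 2 ≡ p
      half = trans (+-distrib-/-∣ʳ 1 {p * 2} (divides p refl)) (m*n/n≡m p 2)

  right-position-bound : ∀ d p → p < 2 ^ d → 1 + p * 2 < 2 ^ suc d
  right-position-bound d p p<2^d =
    subst (suc (1 + p * 2) ≤_) (*-comm (2 ^ d) 2) (*-monoˡ-≤ 2 p<2^d)

  left-position-bound : ∀ d p → p < 2 ^ d → p * 2 < 2 ^ suc d
  left-position-bound d p p<2^d = ≤-trans (n≤1+n _) (right-position-bound d p p<2^d)

  numerator-pos : ∀ d p → 1 ≤ proj₁ (vertex d p)
  numerator-pos zero    p = ≤-refl
  numerator-pos (suc d) p with p % 2
  ... | zero  = numerator-pos d (p / 2)
  ... | suc _ = ≤-trans (numerator-pos d (p / 2)) (m≤m+n _ _)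

  InUnitInterval : Frac → Set
  InUnitInterval (x , y) = 1 ≤ x × x ≤ suc y

  -- Vertices at even positions are the root or left children, so they lie in (0,1].
  even-vertex-inUnit : ∀ d p → InUnitInterval (vertex d (p * 2))
  even-vertex-inUnit zero    p = ≤-refl , ≤-refl
  even-vertex-inUnit (suc d) p rewrite vertex-left d p =
    numerator-pos d p , ≤-trans (m≤m+n _ _) (n≤1+n _)

  -- Iterated right child: R^k(a/b) = a/b + k.
  rightIter : ℕ → Frac → Frac
  rightIter zero    f = f
  rightIter (suc k) f = rightChild (rightIter k f)

  rightIter-form : ∀ k x y → rightIter k (x , y) ≡ (k * suc y + x , y)
  rightIter-form zero    x y = refl
  rightIter-form (suc k) x y = begin
    rightChild (rightIter k (x , y)) ≡⟨ cong rightChild (rightIter-form k x y) ⟩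
    (k * suc y + x + suc y , y)      ≡⟨ cong (_, y) (+-comm (k * suc y + x) (suc y)) ⟩
    (suc y + (k * suc y + x) , y)    ≡⟨ cong (_, y) (+-assoc (suc y) (k * suc y) x) ⟨
    (suc k * suc y + x , y)          ∎

  -- appendOnes k p is the position whose binary expansion is that of p followed
  -- by k ones, i.e. 2ᵏ(p+1) − 1; it is reached from position p by k right steps.
  appendOnes : ℕ → ℕ → ℕ
  appendOnes zero    p = p
  appendOnes (suc k) p = 1 + appendOnes k p * 2

  vertex-appendOnes : ∀ k d p → vertex (k + d) (appendOnes k p) ≡ rightIter k (vertex d p)
  vertex-appendOnes zero    d p = refl
  vertex-appendOnes (suc k) d p =
    trans (vertex-right (k + d) (appendOnes k p)) (cong rightChild (vertex-appendOnes k d p))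

  suc-appendOnes : ∀ k p → suc (appendOnes k p) ≡ suc p * 2 ^ k
  suc-appendOnes zero    p = sym (*-identityʳ (suc p))
  suc-appendOnes (suc k) p = begin
    suc (appendOnes k p) * 2 ≡⟨ cong (_* 2) (suc-appendOnes k p) ⟩
    suc p * 2 ^ k * 2        ≡⟨ *-assoc (suc p) (2 ^ k) 2 ⟩
    suc p * (2 ^ k * 2)      ≡⟨ cong (suc p *_) (*-comm (2 ^ k) 2) ⟩
    suc p * 2 ^ suc k        ∎

  coprime-+⁻ : ∀ {m n o} → n ∣ o → Coprime (o + m) n → Coprime m n
  coprime-+⁻ n∣o cop (i∣m , i∣n) = cop (∣m∣n⇒∣m+n (∣-trans i∣n n∣o) i∣m , i∣n)

  -- Parents of reduced fractions are reduced: if a/(a+b) (resp. (a+b)/b) is in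
  -- lowest terms then so is a/b; here with the positivity offsets of Frac.
  coprime-left-parent : ∀ {a b} → Coprime (suc a) (suc (suc a + b)) → Coprime (suc a) (suc b)
  coprime-left-parent {a} {b} cop = coprime-sym (coprime-+⁻ ∣-refl (coprime-sym cop′))
    where
      cop′ : Coprime (suc a) (suc a + suc b)
      cop′ = subst (λ z → Coprime (suc a) (suc z)) (sym (+-suc a b)) cop

  coprime-right-parent : ∀ {a b} → Coprime (suc (suc b + a)) (suc b) → Coprime (suc a) (suc b)
  coprime-right-parent {a} {b} cop = coprime-+⁻ ∣-refl cop′
    where
      cop′ : Coprime (suc b + suc a) (suc b)
      cop′ = subst (λ z → Coprime (suc z) (suc b)) (sym (+-suc b a)) cop

  -- Undo the
  -- last child step (subtract the smaller part from the larger), as in the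
  -- subtractive Euclidean algorithm; coprimality forces termination at 1/1.
  -- The recursion is on a fuel bound for a + b.
  vertex-surjective : ∀ a b → Coprime (suc a) (suc b) →
    ∃[ d ] ∃[ p ] (p < 2 ^ d × vertex d p ≡ (suc a , b))
  vertex-surjective a b = reach (suc (a + b)) a b ≤-refl
    where
      reach : ∀ fuel a b → a + b < fuel → Coprime (suc a) (suc b) →
        ∃[ d ] ∃[ p ] (p < 2 ^ d × vertex d p ≡ (suc a , b))
      reach zero       _ _ ()
      reach (suc fuel) a b _ cop with compare a b
      reach (suc fuel) a .a _ cop | equal a with cop {suc a} (∣-refl , ∣-refl)
      ... | refl = 0 , 0 , ≤-refl , refl
      reach (suc fuel) a .(suc (a + k)) a+b<fuel cop | less a k
        with reach fuel a k smaller (coprime-left-parent cop)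
        where
          smaller : a + k < fuel
          smaller = <-≤-trans (+-monoʳ-< a (s≤s (m≤n+m k a))) (s≤s⁻¹ a+b<fuel)
      ... | d , p , p<2^d , eq =
        suc d , p * 2 , left-position-bound d p p<2^d ,
        trans (vertex-left d p) (cong leftChild eq)
      reach (suc fuel) .(suc (b + k)) b a+b<fuel cop | greater b k
        with reach fuel k b smaller (coprime-right-parent cop)
        where
          smaller : k + b < fuel
          smaller = ≤-trans (s≤s (≤-trans (≤-reflexive (+-comm k b)) (m≤m+n (b + k) b)))
                            (s≤s⁻¹ a+b<fuel)
      ... | d , p , p<2^d , eq =
        suc d , 1 + p * 2 , right-position-bound d p p<2^d ,
        trans (vertex-right d p) (trans (cong rightChild eq) (cong (_, b) sum))
        where
          sum : suc k + suc b ≡ suc (suc (b + k))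
          sum = cong suc (trans (+-suc k b) (cong suc (+-comm k b)))

  -- Every reduced fraction in (0,1] labels a vertex at an even position: the
  -- root if it is 1/1, and otherwise the left child of the vertex x/(y+1−x).
  even-vertex-surjective : ∀ x y → InUnitInterval (x , y) → Coprime x (suc y) →
    ∃[ d ] ∃[ p ] (p * 2 < 2 ^ d × vertex d (p * 2) ≡ (x , y))
  even-vertex-surjective (suc a) y (_ , x≤1+y) cop with m≤n⇒m<n∨m≡n x≤1+y
  ... | inj₂ refl with cop {suc y} (∣-refl , ∣-refl)
  ...   | refl = 0 , 0 , ≤-refl , refl
  even-vertex-surjective (suc a) y (_ , x≤1+y) cop | inj₁ x≤y
    with m≤n⇒∃[o]m+o≡n (s≤s⁻¹ x≤y)
  ... | b , refl with vertex-surjective a b (coprime-left-parent cop)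
  ... | d , p , p<2^d , eq =
    suc d , p , left-position-bound d p p<2^d ,
    trans (vertex-left d p) (cong leftChild eq)

module Diagonal where

  open Tree
  open import Data.Nat
  open import Data.Nat.Properties
  open import Data.Nat.Logarithm using (⌈log₂_⌉; ⌈log₂⌉-mono-≤; ⌈log₂2^n⌉≡n)
  open import Data.Nat.Solver using (module +-*-Solver)
  open import Data.Product
  open import Relation.Binary.PropositionalEquality

  -- The index m = 2ⁿ·i − 2ⁿ⁻¹ of the theorem, written with n = k + 1 and i + 1
  -- in place of i.
  diagonalIndex : ℕ → ℕ → ℕ
  diagonalIndex k i = 2 ^ suc k * suc i ∸ 2 ^ k

  -- m = (2i + 1)·2ᵏ: the position m − 1 of L_m is 2i followed by k binary ones.
  diagonalIndex≡ : ∀ k i → diagonalIndex k i ≡ suc (appendOnes k (i * 2))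
  diagonalIndex≡ k i = begin
    2 * 2 ^ k * suc i ∸ 2 ^ k             ≡⟨ cong (_∸ 2 ^ k) (odd-multiple (2 ^ k) i) ⟩
    suc (i * 2) * 2 ^ k + 2 ^ k ∸ 2 ^ k   ≡⟨ m+n∸n≡m _ (2 ^ k) ⟩
    suc (i * 2) * 2 ^ k                   ≡⟨ suc-appendOnes k (i * 2) ⟨
    suc (appendOnes k (i * 2))            ∎
    where
      open ≡-Reasoning
      open +-*-Solver
      odd-multiple : ∀ P i → 2 * P * suc i ≡ suc (i * 2) * P + P
      odd-multiple = solve 2 (λ P i → (con 2 :* P) :* (con 1 :+ i)
                                    := (con 1 :+ i :* con 2) :* P :+ P) refl

  diagonalIndex-value : ∀ k i → diagonalIndex k i ≡ suc (i * 2) * 2 ^ k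
  diagonalIndex-value k i = trans (diagonalIndex≡ k i) (suc-appendOnes k (i * 2))

  diagTerm-at-depth : ∀ k i j D → ⌈log₂ (diagonalIndex k i) ⌉ + (j ∸ 1) ≡ k + D →
    diagTerm (diagonalIndex k i) j ≡ toℚ (rightIter k (vertex D (i * 2)))
  diagTerm-at-depth k i j D depth≡ = cong toℚ (begin
    vertex (⌈log₂ m ⌉ + (j ∸ 1)) (m ∸ 1) ≡⟨ cong₂ vertex depth≡ (cong (_∸ 1) (diagonalIndex≡ k i)) ⟩
    vertex (k + D) (appendOnes k (i * 2)) ≡⟨ vertex-appendOnes k D (i * 2) ⟩
    rightIter k (vertex D (i * 2))       ∎)
    where
      open ≡-Reasoning
      m = diagonalIndex k i

  diagonal-start-lower : ∀ k i → k ≤ ⌈log₂ (diagonalIndex k i) ⌉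
  diagonal-start-lower k i = subst (_≤ ⌈log₂ diagonalIndex k i ⌉) (⌈log₂2^n⌉≡n k)
    (⌈log₂⌉-mono-≤ (subst (2 ^ k ≤_) (sym (diagonalIndex-value k i)) (m≤n*m (2 ^ k) (suc (i * 2)))))

  diagonal-start-upper : ∀ k i D → i * 2 < 2 ^ D → ⌈log₂ (diagonalIndex k i) ⌉ ≤ k + D
  diagonal-start-upper k i D position<2^D = subst (⌈log₂ diagonalIndex k i ⌉ ≤_) (⌈log₂2^n⌉≡n (k + D))
    (⌈log₂⌉-mono-≤ (begin
      diagonalIndex k i    ≡⟨ diagonalIndex-value k i ⟩
      suc (i * 2) * 2 ^ k  ≤⟨ *-monoˡ-≤ (2 ^ k) position<2^D ⟩
      2 ^ D * 2 ^ k        ≡⟨ *-comm (2 ^ D) (2 ^ k) ⟩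
      2 ^ k * 2 ^ D        ≡⟨ ^-distribˡ-+-* 2 k D ⟨
      2 ^ (k + D)          ∎))
    where open ≤-Reasoning

  diagTerm-shape : ∀ k i j →
    ∃[ D ] diagTerm (diagonalIndex k i) j ≡ toℚ (rightIter k (vertex D (i * 2)))
  diagTerm-shape k i j = depth ∸ k , diagTerm-at-depth k i j (depth ∸ k) (sym (m+[n∸m]≡n k≤depth))
    where
      depth = ⌈log₂ (diagonalIndex k i) ⌉ + (j ∸ 1)
      k≤depth : k ≤ depth
      k≤depth = ≤-trans (diagonal-start-lower k i) (m≤m+n _ _)

  diagTerm-realises : ∀ k i D → i * 2 < 2 ^ D →
    ∃[ j ] (1 ≤ j × diagTerm (diagonalIndex k i) j ≡ toℚ (rightIter k (vertex D (i * 2))))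
  diagTerm-realises k i D position<2^D =
    j , s≤s z≤n , diagTerm-at-depth k i j D (m+[n∸m]≡n (diagonal-start-upper k i D position<2^D))
    where
      j : ℕ
      j = suc (k + D ∸ ⌈log₂ (diagonalIndex k i) ⌉)

module Band where

  open Tree using (InUnitInterval; rightIter; rightIter-form; coprime-+⁻)
  open import Data.Nat as ℕ using (ℕ; suc; _+_; _*_; _∸_)
  open import Data.Nat.Properties
    using (*-identityʳ; +-comm; +-monoʳ-≤; ≤-trans; m≤n+m; m<m+n; <⇒≤; m+[n∸m]≡n; m<n⇒0<n∸m; m≤n+o⇒m∸n≤o)
  open import Data.Nat.Divisibility using (n∣m*n)
  open import Data.Nat.Coprimality using (Coprime; recompute)
  open import Data.Integer as ℤ using (+_; -[1+_])
  open import Data.Integer.Properties using (pos-*; drop‿+≤+; drop‿+<+)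
  open import Data.Rational using (ℚ; mkℚ; 0ℚ; _<_; _≤_; *<*; toℚᵘ) renaming (_/_ to _÷_)
  open import Data.Rational.Properties
    using (normalize-coprime; toℚᵘ-fromℚᵘ; toℚᵘ-cancel-<; toℚᵘ-cancel-≤; toℚᵘ-mono-<; toℚᵘ-mono-≤)
  import Data.Rational.Unnormalised as ℚᵘ
  import Data.Rational.Unnormalised.Properties as ℚᵘP
  open import Data.Product
  open import Relation.Binary.PropositionalEquality

  -- The normalised fraction a/(b+1) is equivalent to the unnormalised one, so
  -- comparing two such fractions is cross-multiplication of naturals.
  fraction≃ : ∀ a b → toℚᵘ ((+ a) ÷ suc b) ℚᵘ.≃ ℚᵘ.mkℚᵘ (+ a) b
  fraction≃ a b = toℚᵘ-fromℚᵘ (ℚᵘ.mkℚᵘ (+ a) b)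

  fraction-< : ∀ a b c d → a ℕ.* suc d ℕ.< c ℕ.* suc b → (+ a) ÷ suc b < (+ c) ÷ suc d
  fraction-< a b c d ad<cb = toℚᵘ-cancel-<
    (ℚᵘP.<-respˡ-≃ (ℚᵘP.≃-sym (fraction≃ a b)) (ℚᵘP.<-respʳ-≃ (ℚᵘP.≃-sym (fraction≃ c d))
      (ℚᵘ.*<* (subst₂ ℤ._<_ (pos-* a (suc d)) (pos-* c (suc b)) (ℤ.+<+ ad<cb)))))

  fraction-≤ : ∀ a b c d → a ℕ.* suc d ℕ.≤ c ℕ.* suc b → (+ a) ÷ suc b ≤ (+ c) ÷ suc d
  fraction-≤ a b c d ad≤cb = toℚᵘ-cancel-≤
    (ℚᵘP.≤-respˡ-≃ (ℚᵘP.≃-sym (fraction≃ a b)) (ℚᵘP.≤-respʳ-≃ (ℚᵘP.≃-sym (fraction≃ c d))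
      (ℚᵘ.*≤* (subst₂ ℤ._≤_ (pos-* a (suc d)) (pos-* c (suc b)) (ℤ.+≤+ ad≤cb)))))

  fraction-<⁻ : ∀ a b c d → (+ a) ÷ suc b < (+ c) ÷ suc d → a ℕ.* suc d ℕ.< c ℕ.* suc b
  fraction-<⁻ a b c d a/b<c/d
    with ℚᵘP.<-respˡ-≃ (fraction≃ a b) (ℚᵘP.<-respʳ-≃ (fraction≃ c d) (toℚᵘ-mono-< a/b<c/d))
  ... | ℚᵘ.*<* ad<cb = drop‿+<+ (subst₂ ℤ._<_ (sym (pos-* a (suc d))) (sym (pos-* c (suc b))) ad<cb)

  fraction-≤⁻ : ∀ a b c d → (+ a) ÷ suc b ≤ (+ c) ÷ suc d → a ℕ.* suc d ℕ.≤ c ℕ.* suc b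
  fraction-≤⁻ a b c d a/b≤c/d
    with ℚᵘP.≤-respˡ-≃ (fraction≃ a b) (ℚᵘP.≤-respʳ-≃ (fraction≃ c d) (toℚᵘ-mono-≤ a/b≤c/d))
  ... | ℚᵘ.*≤* ad≤cb = drop‿+≤+ (subst₂ ℤ._≤_ (sym (pos-* a (suc d))) (sym (pos-* c (suc b))) ad≤cb)

  -- q lies in the band (k, k+1]; positivity is listed separately, as in the theorem.
  InBand : ℕ → ℚ → Set
  InBand k q = 0ℚ < q × (+ k) ÷ 1 < q × q ≤ (+ suc k) ÷ 1

  rightIter-inBand : ∀ k f → InUnitInterval f → InBand k (toℚ (rightIter k f))
  rightIter-inBand k (x , y) (1≤x , x≤1+y) rewrite rightIter-form k x y =
    fraction-< 0 0 N y (subst (0 ℕ.<_) N≡N*1 (≤-trans 1≤x (m≤n+m x _))) ,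
    fraction-< k 0 N y (subst (k * suc y ℕ.<_) N≡N*1 (m<m+n (k * suc y) 1≤x)) ,
    fraction-≤ N y (suc k) 0 (subst (ℕ._≤ suc k * suc y) N≡N*1
      (subst (N ℕ.≤_) (+-comm (k * suc y) (suc y)) (+-monoʳ-≤ (k * suc y) x≤1+y)))
    where
      N = k * suc y + x
      N≡N*1 : N ≡ N * 1
      N≡N*1 = sym (*-identityʳ N)

  -- Conversely every q in the band is R^k of a reduced fraction in (0,1]: if
  -- q = N/(d+1) in lowest terms, it is R^k(x/(d+1)) with x = N − k(d+1).
  inBand-inverse : ∀ k q → InBand k q →
    ∃[ x ] ∃[ y ] (InUnitInterval (x , y) × Coprime x (suc y) × toℚ (rightIter k (x , y)) ≡ q)
  inBand-inverse k (mkℚ -[1+ _ ] _ _) (*<* () , _)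
  inBand-inverse k (mkℚ (+ N) d c) (_ , k<q , q≤k+1) = x , d , (1≤x , x≤1+d) , coprime , q≡
    where
      N/d≡q : (+ N) ÷ suc d ≡ mkℚ (+ N) d c
      N/d≡q = normalize-coprime c
      lower : k * suc d ℕ.< N
      lower = subst (k * suc d ℕ.<_) (*-identityʳ N)
        (fraction-<⁻ k 0 N d (subst ((+ k) ÷ 1 <_) (sym N/d≡q) k<q))
      upper : N ℕ.≤ suc d + k * suc d
      upper = subst (ℕ._≤ suc k * suc d) (*-identityʳ N)
        (fraction-≤⁻ N d (suc k) 0 (subst (_≤ (+ suc k) ÷ 1) (sym N/d≡q) q≤k+1))
      x = N ∸ k * suc d
      N≡ : k * suc d + x ≡ N
      N≡ = m+[n∸m]≡n (<⇒≤ lower)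
      1≤x : 1 ℕ.≤ x
      1≤x = m<n⇒0<n∸m lower
      x≤1+d : x ℕ.≤ suc d
      x≤1+d = m≤n+o⇒m∸n≤o N (k * suc d) (subst (N ℕ.≤_) (+-comm (suc d) (k * suc d)) upper)
      coprime : Coprime x (suc d)
      coprime = coprime-+⁻ (n∣m*n k) (subst (λ z → Coprime z (suc d)) (sym N≡) (recompute c))
      q≡ : toℚ (rightIter k (x , d)) ≡ mkℚ (+ N) d c
      q≡ = trans (cong toℚ (trans (rightIter-form k x d) (cong (_, d) N≡))) N/d≡q

open import Data.Nat using (ℕ; _*_; _∸_; _^_; _≤_)
open import Data.Product using (_×_; ∃-syntax)
open import Data.Rational using (ℚ; 0ℚ; _<_) renaming (_≤_ to _≤ℚ_)
open import Data.Rational using () renaming (_/_ to _÷_)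
open import Data.Integer using (+_)
open import Relation.Binary.PropositionalEquality using (_≡_)
open import Function.Bundles using (_⇔_)

open import Data.Nat using (zero; suc; s≤s; z≤n)
open import Data.Product using (_,_)
open import Relation.Binary.PropositionalEquality using (sym; trans; subst; cong)
open import Function.Bundles using (mk⇔)
open Tree using (rightIter; even-vertex-inUnit; even-vertex-surjective)
open Diagonal using (diagTerm-shape; diagTerm-realises)
open Band using (InBand; rightIter-inBand; inBand-inverse)

mainTheorem3 : (n : ℕ) → 1 ≤ n → (q : ℚ) →
    (∃[ i ] ∃[ j ] (1 ≤ i × 1 ≤ j × diagTerm (2 ^ n * i ∸ 2 ^ (n ∸ 1)) j ≡ q))
      ⇔ (0ℚ < q × ((+ (n ∸ 1)) ÷ 1) < q × q ≤ℚ ((+ n) ÷ 1))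
mainTheorem3 (suc k) _ q = mk⇔ onDiagonal⇒inBand inBand⇒onDiagonal
  where
    onDiagonal⇒inBand : ∃[ i ] ∃[ j ] (1 ≤ i × 1 ≤ j × diagTerm (2 ^ suc k * i ∸ 2 ^ (suc k ∸ 1)) j ≡ q) →
      InBand k q
    onDiagonal⇒inBand (zero , _ , () , _)
    onDiagonal⇒inBand (suc i , j , _ , _ , term≡q) =
      let D , term≡ = diagTerm-shape k i j
      in subst (InBand k) (trans (sym term≡) term≡q)
               (rightIter-inBand k (vertex D (i * 2)) (even-vertex-inUnit D i))

    inBand⇒onDiagonal : InBand k q →
      ∃[ i ] ∃[ j ] (1 ≤ i × 1 ≤ j × diagTerm (2 ^ suc k * i ∸ 2 ^ (suc k ∸ 1)) j ≡ q)
    inBand⇒onDiagonal band =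
      let x , y , unit , coprime , fraction≡q = inBand-inverse k q band
          D , p , position<2^D , vertex≡ = even-vertex-surjective x y unit coprime
          j , 1≤j , term≡ = diagTerm-realises k p D position<2^D
      in suc p , j , s≤s z≤n , 1≤j ,
         trans term≡ (trans (cong (λ f → toℚ (rightIter k f)) vertex≡) fraction≡q)
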